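{- The infinite comb graph $B_\infty$ has infinite metric dimension, i.e. it has no finite resolving set.
   Context: The infinite comb graph $B_\infty$ has vertex set $\{u_i:i\ge 0\}\cup\{v_i:i\ge 0\}$ and edge set $\{u_iu_{i+1}:i\ge 0\}\cup\{u_iv_i:i\ge 0\}$. $d(u,v)$ is the shortest-path distance. A vertex $x$ resolves $u,v$ if $d(u,x)\neq d(v,x)$; a set $S$ of vertices is a resolving set if every pair of distinct vertices is resolved by some vertex of $S$. The metric dimension is the minimum cardinality of a resolving set if a finite resolving set exists, and infinite otherwise. -}

module Defs where

open import Data.Nat using (ℕ; zero; suc; _<_)
open import Data.List using (List)
open import Data.List.Membership.Propositional using (_∈_)
open import Data.Product using (Σ; _×_; ∃-syntax)
open import Relation.Binary.PropositionalEquality using (_≡_; _≢_)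
open import Relation.Nullary using (¬_)

-- Vertices of the infinite comb B∞ : spine vertices u i and teeth v i.
data Vertex : Set where
  u : ℕ → Vertex
  v : ℕ → Vertex

data Edge : Vertex → Vertex → Set where
  spine     : ∀ i → Edge (u i) (u (suc i))
  spine-rev : ∀ i → Edge (u (suc i)) (u i)
  tooth     : ∀ i → Edge (u i) (v i)
  tooth-rev : ∀ i → Edge (v i) (u i)

data Walk : Vertex → Vertex → ℕ → Set where
  here : ∀ {x} → Walk x x zero
  step : ∀ {x y z n} → Edge x y → Walk y z n → Walk x z (suc n)

IsDist : Vertex → Vertex → ℕ → Set
IsDist x y n = Walk x y n × (∀ m → m < n → ¬ Walk x y m)

Resolves : Vertex → Vertex → Vertex → Set
Resolves x a b = ∃[ n ] ∃[ m ] (IsDist a x n × IsDist b x m × n ≢ m)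

IsResolvingSet : List Vertex → Set
IsResolvingSet S = ∀ a b → a ≢ b → ∃[ x ] (x ∈ S × Resolves x a b)

module Submission where

-- Idea: past the largest index N occurring in S, the tooth v N and the spine
-- vertex u (N+1) are "twins" as seen from S: every x with index < N is at the
-- same distance from both, so no vertex of S resolves them.

open import Defs
open import Data.List using (List; []; _∷_)
open import Data.List.Membership.Propositional using (_∈_)
open import Data.List.Relation.Unary.Any using (here; there)
open import Data.Nat using (ℕ; suc; _<_; _≤_; _<?_; _⊔_; z≤n; s≤s)
open import Data.Nat.Properties
  using (≤-antisym; n≤1+n; ≤-refl; ≤-trans; ≤-<-trans; ≮⇒≥; <-irrefl; m≤n⇒m≤1+n; m≤m⊔n; m≤n⊔m)
open import Data.Product using (_×_; ∃-syntax; _,_)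
open import Data.Sum using (_⊎_; inj₁; inj₂)
open import Data.Empty using (⊥-elim)
open import Relation.Nullary using (¬_; yes; no)
open import Relation.Binary.PropositionalEquality using (_≡_; refl; sym; subst; subst₂)

idx : Vertex → ℕ
idx (u i) = i
idx (v i) = i

index-bound : (S : List Vertex) → ∃[ N ] (∀ {x} → x ∈ S → idx x < N)
index-bound [] = 0 , λ ()
index-bound (y ∷ S) with index-bound S
... | N , below = suc (idx y) ⊔ N , bound
  where
    bound : ∀ {x} → x ∈ y ∷ S → idx x < suc (idx y) ⊔ N
    bound (here refl) = m≤m⊔n (suc (idx y)) N
    bound (there x∈S) = ≤-trans (below x∈S) (m≤n⊔m (suc (idx y)) N)

Contraction : (Vertex → Vertex) → Set
Contraction f = ∀ {a b} → Edge a b → f a ≡ f b ⊎ Edge (f a) (f b)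

map-walk : ∀ {f a b n} → Contraction f → Walk a b n → ∃[ k ] (k ≤ n × Walk (f a) (f b) k)
map-walk con here = 0 , z≤n , here
map-walk {f} {b = b} con (step e w) with map-walk con w | con e
... | k , k≤n , w′ | inj₁ fa≡fy = k , m≤n⇒m≤1+n k≤n , subst (λ t → Walk t (f b) k) (sym fa≡fy) w′
... | k , k≤n , w′ | inj₂ e′    = suc k , s≤s k≤n , step e′ w′

ρ : ℕ → Vertex → Vertex
ρ N x with idx x <? N
... | yes _ = x
... | no  _ = u N

ρ-fix : ∀ {N} x → idx x < N → ρ N x ≡ x
ρ-fix {N} x x<N with idx x <? N
... | yes _   = refl
... | no  x≮N = ⊥-elim (x≮N x<N)

ρ-collapse : ∀ {N} x → N ≤ idx x → ρ N x ≡ u N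
ρ-collapse {N} x N≤x with idx x <? N
... | yes x<N = ⊥-elim (<-irrefl refl (≤-<-trans N≤x x<N))
... | no  _   = refl

reverse : ∀ {a b} → Edge a b → Edge b a
reverse (spine i)     = spine-rev i
reverse (spine-rev i) = spine i
reverse (tooth i)     = tooth-rev i
reverse (tooth-rev i) = tooth i

reverse-step : ∀ {a b} → a ≡ b ⊎ Edge a b → b ≡ a ⊎ Edge b a
reverse-step (inj₁ a≡b) = inj₁ (sym a≡b)
reverse-step (inj₂ e)   = inj₂ (reverse e)

-- Spine edges are kept below N and collapsed from N on; the only one
-- straddling position N is u (N-1) — u N, which is kept.
ρ-spine : ∀ N j → ρ N (u j) ≡ ρ N (u (suc j)) ⊎ Edge (ρ N (u j)) (ρ N (u (suc j)))
ρ-spine N j with j <? N | suc j <? N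
... | yes _   | yes _    = inj₂ (spine j)
... | yes j<N | no  j+1≮N = inj₂ (subst (λ k → Edge (u j) (u k)) (≤-antisym j<N (≮⇒≥ j+1≮N)) (spine j))
... | no  j≮N | yes j+1<N = ⊥-elim (j≮N (≤-trans (n≤1+n (suc j)) j+1<N))
... | no  _   | no  _    = inj₁ refl

ρ-tooth : ∀ N j → ρ N (u j) ≡ ρ N (v j) ⊎ Edge (ρ N (u j)) (ρ N (v j))
ρ-tooth N j with j <? N
... | yes _ = inj₂ (tooth j)
... | no  _ = inj₁ refl

ρ-contraction : ∀ N → Contraction (ρ N)
ρ-contraction N (spine j)     = ρ-spine N j
ρ-contraction N (spine-rev j) = reverse-step (ρ-spine N j)
ρ-contraction N (tooth j)     = ρ-tooth N j
ρ-contraction N (tooth-rev j) = reverse-step (ρ-tooth N j)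

-- Its first step enters a
-- vertex that ρ N sends to u N, and ρ N maps the rest onto a walk u N → x.
shortcut : ∀ {N a b x n} → N ≤ idx a → (∀ {y} → Edge a y → N ≤ idx y) →
           Edge b (u N) → idx x < N → Walk a x n → ∃[ k ] (k ≤ n × Walk b x k)
shortcut N≤a _ _ x<N here = ⊥-elim (<-irrefl refl (≤-<-trans N≤a x<N))
shortcut {N} {x = x} _ far b→uN x<N (step {y = y} e w) with map-walk (ρ-contraction N) w
... | k , k≤n , w′ = suc k , s≤s k≤n , step b→uN uN→x
  where
    uN→x : Walk (u N) x k
    uN→x = subst₂ (λ s t → Walk s t k) (ρ-collapse y (far e)) (ρ-fix x x<N) w′

dist-mono : ∀ {a b x n m} → (∀ {l} → Walk a x l → ∃[ k ] (k ≤ l × Walk b x k)) →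
            IsDist a x n → IsDist b x m → m ≤ n
dist-mono transfer (wa , _) (_ , minimal-b) with transfer wa
... | k , k≤n , wb = ≮⇒≥ (λ n<m → minimal-b k (≤-<-trans k≤n n<m) wb)

twins : ∀ {N x n m} → idx x < N → IsDist (v N) x n → IsDist (u (suc N)) x m → n ≡ m
twins {N} {x} x<N dv du = ≤-antisym (dist-mono from-u du dv) (dist-mono from-v dv du)
  where
    from-v : ∀ {l} → Walk (v N) x l → ∃[ k ] (k ≤ l × Walk (u (suc N)) x k)
    from-v = shortcut ≤-refl (λ { (tooth-rev _) → ≤-refl }) (spine-rev N) x<N
    from-u : ∀ {l} → Walk (u (suc N)) x l → ∃[ k ] (k ≤ l × Walk (v N) x k)
    from-u = shortcut (n≤1+n N)
                      (λ { (spine _)     → ≤-trans (n≤1+n N) (n≤1+n (suc N))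
                         ; (spine-rev _) → ≤-refl
                         ; (tooth _)     → n≤1+n N })
                      (tooth-rev N) x<N

proposition2 : (S : List Vertex) → ¬ IsResolvingSet S
proposition2 S resolving with index-bound S
... | N , below with resolving (v N) (u (suc N)) (λ ())
... | x , x∈S , n , m , dv , du , n≢m = n≢m (twins (below x∈S) dv du)
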